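{- Let $T$ be a numerical semigroup, $d\ge1$, and let $S=\{\mathbf{a}\in\mathbb{N}^d:|\mathbf{a}|\in T\}$ be the $T$-graded GNS. Then $S$ is quasi-irreducible if and only if $T$ is irreducible, and $S$ is quasi-symmetric if and only if $T$ is symmetric.
   Context: $|\mathbf{x}|$ is the sum of coordinates of $\mathbf{x}\in\mathbb{N}^d$; $\le$ is the componentwise partial order. For a GNS $S\subseteq\mathbb{N}^d$ (submonoid with finite complement $\operatorname{H}(S)$): $\operatorname{FA}(S)$ is the set of $\le$-maximal elements of $\operatorname{H}(S)$, $\tau(S)=|\operatorname{FA}(S)|$; $\operatorname{PF}(S)=\{\mathbf{x}\in\operatorname{H}(S):\mathbf{x}+\mathbf{s}\in S\ \forall\mathbf{s}\in S\setminus\{\mathbf{0}\}\}$, $\operatorname{t}(S)=|\operatorname{PF}(S)|$, $\operatorname{SG}(S)=\{\mathbf{x}\in\operatorname{PF}(S):2\mathbf{x}\in S\}$. $S$ is quasi-irreducible if for every $\mathbf{x}\in\operatorname{H}(S)$ either $2\mathbf{x}\in\operatorname{FA}(S)$ or there is $\mathbf{F}\in\operatorname{FA}(S)$ with $\mathbf{F}-\mathbf{x}\in S$; $S$ is quasi-symmetric if $\tau(S)=\operatorname{t}(S)$. For a numerical semigroup $T$ with Frobenius number $\operatorname{F}(T)=\max(\mathbb{Z}\setminus T)$: $T$ is irreducible if it is not the intersection of two numerical semigroups properly containing it, equivalently $\operatorname{SG}(T)=\{\operatorname{F}(T)\}$; $T$ is symmetric if it is irreducible and $\operatorname{PF}(T)=\{\operatorname{F}(T)\}$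 (equivalently $\operatorname{PF}(T)=\{\operatorname{F}(T)\}$). -}

module Defs where

open import Data.Nat using (ℕ; zero; suc; _+_; _*_; _≤_; _<_)
open import Data.Bool using (Bool; true; false)
open import Data.Integer as ℤ using (ℤ; +_; -[1+_])
open import Data.Vec using (Vec; []; _∷_; zipWith; replicate; sum)
open import Data.Vec.Relation.Binary.Pointwise.Inductive using (Pointwise)
open import Data.List using (List; length)
open import Data.List.Membership.Propositional using (_∈_)
open import Data.List.Relation.Unary.Unique.Propositional using (Unique)
open import Data.Product using (Σ; ∃; _×_; _,_)
open import Data.Sum using (_⊎_)
open import Data.Empty using (⊥)
open import Relation.Nullary using (¬_)
open import Relation.Binary.PropositionalEquality using (_≡_; _≢_)
open import Function.Bundles using (_⇔_)

_≤ᵥ_ : ∀ {d} → Vec ℕ d → Vec ℕ d → Set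
_≤ᵥ_ = Pointwise _≤_

_+ᵥ_ : ∀ {d} → Vec ℕ d → Vec ℕ d → Vec ℕ d
_+ᵥ_ = zipWith _+_

𝟎 : ∀ {d} → Vec ℕ d
𝟎 {d} = replicate d 0

∣_∣ᵥ : ∀ {d} → Vec ℕ d → ℕ
∣ x ∣ᵥ = sum x

HasCard : {A : Set} → (A → Set) → ℕ → Set
HasCard {A} X k =
  Σ (List A) λ L → Unique L × (∀ x → (x ∈ L) ⇔ X x) × length L ≡ k

module _ {d : ℕ} (S : Vec ℕ d → Set) where

  Hole : Vec ℕ d → Set
  Hole x = ¬ S x

  FA : Vec ℕ d → Set
  FA x = Hole x × (∀ y → Hole y → x ≤ᵥ y → y ≡ x)

  PF : Vec ℕ d → Set
  PF x = Hole x × (∀ s → S s → s ≢ 𝟎 → S (x +ᵥ s))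

  -- quasi-irreducible: for every hole x, 2x ∈ FA(S) or F - x ∈ S for some F ∈ FA(S)
  -- (F - x ∈ S ⊆ ℕ^d means: F = x + s for some s ∈ S)
  QuasiIrreducible : Set
  QuasiIrreducible =
    ∀ x → Hole x →
      FA (x +ᵥ x) ⊎ Σ (Vec ℕ d) (λ F → FA F × Σ (Vec ℕ d) (λ s → S s × F ≡ x +ᵥ s))

  QuasiSymmetric : Set
  QuasiSymmetric = Σ ℕ λ k → HasCard FA k × HasCard PF k

_∈ₙ_ : ℕ → (ℕ → Bool) → Set
n ∈ₙ T = T n ≡ true

NumericalSemigroup : (ℕ → Bool) → Set
NumericalSemigroup T =
  (0 ∈ₙ T) ×
  (∀ m n → m ∈ₙ T → n ∈ₙ T → (m + n) ∈ₙ T) ×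
  Σ ℕ (λ N → ∀ n → N ≤ n → n ∈ₙ T)

_⊊_ : (ℕ → Bool) → (ℕ → Bool) → Set
T ⊊ T' = (∀ n → n ∈ₙ T → n ∈ₙ T') × Σ ℕ (λ n → n ∈ₙ T' × ¬ (n ∈ₙ T))

Irreducible : (ℕ → Bool) → Set
Irreducible T =
  ¬ Σ (ℕ → Bool) (λ T₁ → Σ (ℕ → Bool) (λ T₂ →
      NumericalSemigroup T₁ × NumericalSemigroup T₂ × T ⊊ T₁ × T ⊊ T₂ ×
      (∀ n → n ∈ₙ T ⇔ (n ∈ₙ T₁ × n ∈ₙ T₂))))

_∈ℤ_ : ℤ → (ℕ → Bool) → Set
(+ n) ∈ℤ T = n ∈ₙ T
-[1+ n ] ∈ℤ T = ⊥

IsFrobenius : (ℕ → Bool) → ℤ → Set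
IsFrobenius T f = ¬ (f ∈ℤ T) × (∀ z → f ℤ.< z → z ∈ℤ T)

PFₙ : (ℕ → Bool) → ℤ → Set
PFₙ T z = ¬ (z ∈ℤ T) × (∀ s → s ∈ₙ T → s ≢ 0 → (z ℤ.+ + s) ∈ℤ T)

Symmetric : (ℕ → Bool) → Set
Symmetric T = Irreducible T × (∀ z → PFₙ T z ⇔ IsFrobenius T z)

Graded : (d : ℕ) → (ℕ → Bool) → Vec ℕ d → Set
Graded d T a = ∣ a ∣ᵥ ∈ₙ T

-- If T = ℕ there is nothing to prove, so let F be the Frobenius number of T. As d ≥ 1, every natural
-- number is a coordinate sum, and one checks FA(S) = {a : |a| = F} and PF(S) = {a : |a| ∈ PF(T)}.
-- Hence S is quasi-irreducible iff every gap h of T has 2h = F or F − h ∈ T, the classical criterion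
-- for irreducibility: under it every proper oversemigroup contains F, and otherwise the largest gap
-- violating it is a special gap g ≠ F, so T = (T ∪ {g}) ∩ (T ∪ {F}). Likewise τ(S) = t(S) forces
-- PF(T) = {F}, since a second pseudo-Frobenius number n of T puts (n, 0, …, 0) into PF(S) ∖ FA(S);
-- and PF(T) = {F} implies the criterion, hence symmetry.

module Submission where

open import Defs
open import Data.Nat using (ℕ; _≤_)
open import Data.Bool using (Bool)
open import Data.Product using (_×_)
open import Function.Bundles using (_⇔_)

open import Data.Nat using (zero; suc; _+_; _∸_; _<_; _≟_; _≤?_; _≡ᵇ_; z≤n; s≤s; s≤s⁻¹; z<s)
open import Data.Nat.Properties
open import Data.Bool using (true; _∨_)
import Data.Bool as Bool
open import Data.Bool.Properties using (T-≡; T-∨)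
open import Data.Integer as ℤ using (ℤ; -[1+_]; +<+; -<+; -<-)
import Data.Integer.Properties as ℤ
open import Data.Vec using (Vec; []; _∷_; sum; head)
open import Data.Vec.Properties using (≡-dec)
open import Data.Vec.Relation.Binary.Pointwise.Inductive using ([]; _∷_)
open import Data.List
  using (List; []; _∷_; [_]; length; filter; deduplicate; upTo; cartesianProductWith)
open import Data.List.Membership.Propositional using (_∈_)
open import Data.List.Membership.Propositional.Properties
  using (∈-upTo⁺; ∈-cartesianProductWith⁺; ∈-filter⁺; ∈-filter⁻; ∈-deduplicate⁺; ∈-deduplicate⁻)
open import Data.List.Relation.Unary.Any using (here; there)
open import Data.List.Relation.Unary.All as All using ()
open import Data.List.Relation.Unary.Unique.Propositional using (Unique; []; _∷_)
open import Data.Product using (Σ; ∃; _,_; proj₁; proj₂)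
open import Data.Sum as Sum using (_⊎_; inj₁; inj₂)
open import Data.Empty using (⊥-elim)
open import Function using (_∘_; const)
open import Function.Bundles using (mk⇔; Equivalence)
open import Function.Properties.Equivalence using () renaming (sym to ⇔-sym; trans to ⇔-trans)
open import Relation.Nullary using (¬_; Dec; yes; no; contradiction; ¬?)
open import Relation.Nullary.Decidable using (_×-dec_; decidable-stable)
open import Relation.Unary using (Decidable)
open import Relation.Binary.PropositionalEquality
  using (_≡_; _≢_; refl; sym; trans; cong; cong₂; subst; module ≡-Reasoning)
open import Algebra.Properties.CommutativeSemigroup +-commutativeSemigroup using (interchange)

open Equivalence using (to; from)

record Greatest (P : ℕ → Set) (B : ℕ) : Set where
  field
    value   : ℕ
    holds   : P value
    ≤-bound : value ≤ B
    maximal : ∀ {n} → value < n → n ≤ B → ¬ P n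

greatest : {P : ℕ → Set} → Decidable P → ∀ {h} B → h ≤ B → P h → Greatest P B
greatest P? zero z≤n P0 = record
  { value = 0 ; holds = P0 ; ≤-bound = z≤n ; maximal = λ 0<n n≤0 _ → <⇒≱ 0<n n≤0 }
greatest {P} P? (suc B) h≤1+B Ph with P? (suc B)
... | yes P[1+B] = record
  { value = suc B ; holds = P[1+B] ; ≤-bound = ≤-refl ; maximal = λ B<n n≤B _ → <⇒≱ B<n n≤B }
... | no ¬P[1+B] = record
  { value = value ; holds = holds ; ≤-bound = m≤n⇒m≤1+n ≤-bound
  ; maximal = λ v<n n≤1+B Pn → maximal v<n (≤B n≤1+B Pn) Pn }
  where
  ≤B : ∀ {n} → n ≤ suc B → P n → n ≤ B
  ≤B n≤1+B Pn = s≤s⁻¹ (≤∧≢⇒< n≤1+B λ { refl → ¬P[1+B] Pn })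
  open Greatest (greatest P? B (≤B h≤1+B Ph) Ph)

delete : {A : Set} {x : A} (ys : List A) → x ∈ ys →
  Σ (List A) λ ys′ → length ys ≡ suc (length ys′) × (∀ {z} → z ∈ ys → z ≢ x → z ∈ ys′)
delete (y ∷ ys) (here refl) = ys , refl , λ
  { (here refl) z≢y → contradiction refl z≢y
  ; (there z∈ys) _ → z∈ys }
delete (y ∷ ys) (there x∈ys) with delete ys x∈ys
... | ys′ , len , ∈ys′ = y ∷ ys′ , cong suc len , λ
  { (here refl) _ → here refl
  ; (there z∈ys) z≢x → there (∈ys′ z∈ys z≢x) }

unique-⊆⇒length≤ : {A : Set} {xs ys : List A} →
  Unique xs → (∀ {z} → z ∈ xs → z ∈ ys) → length xs ≤ length ys
unique-⊆⇒length≤ [] _ = z≤n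
unique-⊆⇒length≤ {xs = x ∷ xs} {ys} (x∉xs ∷ u) xs⊆ys with delete ys (xs⊆ys (here refl))
... | ys′ , len , ∈ys′ = subst (suc (length xs) ≤_) (sym len)
  (s≤s (unique-⊆⇒length≤ u λ z∈xs →
    ∈ys′ (xs⊆ys (there z∈xs)) λ { refl → All.lookup x∉xs z∈xs refl }))

HasCard-cong : {A : Set} {P Q : A → Set} {k : ℕ} →
  (∀ x → P x ⇔ Q x) → HasCard P k → HasCard Q k
HasCard-cong P⇔Q (L , u , ∈L⇔P , len) = L , u , (λ x → ⇔-trans (∈L⇔P x) (P⇔Q x)) , len

HasCard-∅ : {A : Set} {P : A → Set} → (∀ x → ¬ P x) → HasCard P 0
HasCard-∅ ∅ = [] , [] , (λ x → mk⇔ (λ ()) (⊥-elim ∘ ∅ x)) , refl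

⊆-sameCard⇒⊇ : {A : Set} {P Q : A → Set} {k : ℕ} → (∀ {x} → P x → Q x) →
  HasCard P k → HasCard Q k → ∀ {x} → Q x → ¬ ¬ P x
⊆-sameCard⇒⊇ P⊆Q (LP , uP , ∈LP , refl) (LQ , uQ , ∈LQ , lenQ) {v} Qv ¬Pv =
  <-irrefl (sym lenQ) (unique-⊆⇒length≤ (All.tabulate v∉LP ∷ uP) ⊆LQ)
  where
  v∉LP : ∀ {x} → x ∈ LP → v ≢ x
  v∉LP x∈ refl = ¬Pv (to (∈LP v) x∈)
  ⊆LQ : ∀ {z} → z ∈ v ∷ LP → z ∈ LQ
  ⊆LQ (here refl) = from (∈LQ v) Qv
  ⊆LQ {z} (there z∈) = from (∈LQ z) (P⊆Q (to (∈LP z) z∈))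

sum-𝟎 : ∀ d → sum (𝟎 {d}) ≡ 0
sum-𝟎 zero = refl
sum-𝟎 (suc d) = sum-𝟎 d

sum-+ᵥ : ∀ {d} (x y : Vec ℕ d) → sum (x +ᵥ y) ≡ sum x + sum y
sum-+ᵥ [] [] = refl
sum-+ᵥ (a ∷ x) (b ∷ y) = trans (cong (a + b +_) (sum-+ᵥ x y)) (interchange a b (sum x) (sum y))

sum≡0⇒𝟎 : ∀ {d} (x : Vec ℕ d) → sum x ≡ 0 → x ≡ 𝟎
sum≡0⇒𝟎 [] _ = refl
sum≡0⇒𝟎 (a ∷ x) eq = cong₂ _∷_ (m+n≡0⇒m≡0 a eq) (sum≡0⇒𝟎 x (m+n≡0⇒n≡0 a eq))

sum-mono-≤ᵥ : ∀ {d} {x y : Vec ℕ d} → x ≤ᵥ y → sum x ≤ sum y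
sum-mono-≤ᵥ [] = z≤n
sum-mono-≤ᵥ (a≤b ∷ x≤y) = +-mono-≤ a≤b (sum-mono-≤ᵥ x≤y)

≤ᵥ∧sum≡⇒≡ : ∀ {d} {x y : Vec ℕ d} → x ≤ᵥ y → sum x ≡ sum y → x ≡ y
≤ᵥ∧sum≡⇒≡ [] _ = refl
≤ᵥ∧sum≡⇒≡ {x = a ∷ x} {b ∷ y} (a≤b ∷ x≤y) eq =
  cong₂ _∷_ a≡b (≤ᵥ∧sum≡⇒≡ x≤y (+-cancelˡ-≡ a _ _ eq′))
  where
  b≤a : b ≤ a
  b≤a = +-cancelʳ-≤ (sum y) b a (subst (_≤ a + sum y) eq (+-monoʳ-≤ a (sum-mono-≤ᵥ x≤y)))
  a≡b : a ≡ b
  a≡b = ≤-antisym a≤b b≤a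
  eq′ : a + sum x ≡ a + sum y
  eq′ = trans eq (cong (_+ sum y) (sym a≡b))

≤ᵥ-+ᵥ : ∀ {d} (x y : Vec ℕ d) → x ≤ᵥ (x +ᵥ y)
≤ᵥ-+ᵥ [] [] = []
≤ᵥ-+ᵥ (a ∷ x) (b ∷ y) = m≤m+n a b ∷ ≤ᵥ-+ᵥ x y

at₀ : ∀ {d} → ℕ → Vec ℕ (suc d)
at₀ n = n ∷ 𝟎

sum-at₀ : ∀ {d} n → sum (at₀ {d} n) ≡ n
sum-at₀ {d} n = trans (cong (n +_) (sum-𝟎 d)) (+-identityʳ n)

sum-+ᵥ-at₀ : ∀ {d} (x : Vec ℕ (suc d)) n → sum (x +ᵥ at₀ n) ≡ sum x + n
sum-+ᵥ-at₀ {d} x n = trans (sum-+ᵥ x (at₀ n)) (cong (sum x +_) (sum-at₀ {d} n))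

box : ∀ d → ℕ → List (Vec ℕ d)
box zero n = [ [] ]
box (suc d) n = cartesianProductWith _∷_ (upTo (suc n)) (box d n)

sum≤⇒∈box : ∀ {d n} (x : Vec ℕ d) → sum x ≤ n → x ∈ box d n
sum≤⇒∈box [] _ = here refl
sum≤⇒∈box (a ∷ x) a+x≤n = ∈-cartesianProductWith⁺ _∷_
  (∈-upTo⁺ (s≤s (≤-trans (m≤m+n a (sum x)) a+x≤n)))
  (sum≤⇒∈box x (≤-trans (m≤n+m (sum x) a) a+x≤n))

levelSet-finite : ∀ d n → ∃ (HasCard (λ (x : Vec ℕ d) → sum x ≡ n))
levelSet-finite d n = length L , L , deduplicate-! candidates , ∈L⇔ , refl
  where
  open import Data.List.Relation.Unary.Unique.DecPropositional.Properties (≡-dec {n = d} _≟_)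
    using (deduplicate-!)
  candidates = filter (λ x → sum x ≟ n) (box d n)
  L = deduplicate (≡-dec _≟_) candidates
  ∈L⇔ : ∀ x → x ∈ L ⇔ sum x ≡ n
  ∈L⇔ x = mk⇔
    (proj₂ ∘ ∈-filter⁻ (λ y → sum y ≟ n) {xs = box d n} ∘ ∈-deduplicate⁻ (≡-dec _≟_) candidates)
    (λ eq → ∈-deduplicate⁺ (≡-dec _≟_)
      (∈-filter⁺ (λ y → sum y ≟ n) (sum≤⇒∈box x (≤-reflexive eq)) eq))

_∉ₙ_ : ℕ → (ℕ → Bool) → Set
n ∉ₙ T = ¬ n ∈ₙ T

_∈ₙ?_ : ∀ n T → Dec (n ∈ₙ T)
n ∈ₙ? T = T n Bool.≟ true

_∉ₙ?_ : ∀ n T → Dec (n ∉ₙ T)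
n ∉ₙ? T = ¬? (n ∈ₙ? T)

IsPseudoFrobenius : (ℕ → Bool) → ℕ → Set
IsPseudoFrobenius T n = n ∉ₙ T × (∀ s → s ∈ₙ T → s ≢ 0 → (n + s) ∈ₙ T)

IsSpecialGap : (ℕ → Bool) → ℕ → Set
IsSpecialGap T n = IsPseudoFrobenius T n × (n + n) ∈ₙ T

record IsLargestGap (T : ℕ → Bool) (F : ℕ) : Set where
  field
    gap   : F ∉ₙ T
    above : ∀ {n} → F < n → n ∈ₙ T

full-or-largestGap : ∀ {T} → NumericalSemigroup T → (∀ n → n ∈ₙ T) ⊎ ∃ (IsLargestGap T)
full-or-largestGap {T} (_ , _ , N , ≥N⇒∈) with anyUpTo? (_∉ₙ? T) N
... | yes (h , h<N , h∉T) = inj₂ (value , record { gap = holds ; above = above })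
  where
  open Greatest (greatest (_∉ₙ? T) N (<⇒≤ h<N) h∉T)
  above : ∀ {n} → value < n → n ∈ₙ T
  above {n} v<n =
    Sum.[ decidable-stable (n ∈ₙ? T) ∘ maximal v<n , ≥N⇒∈ n ∘ <⇒≤ ] (≤-<-connex n N)
... | no no-gap<N = inj₁ λ n → decidable-stable (n ∈ₙ? T) λ n∉T →
  Sum.[ (λ N≤n → n∉T (≥N⇒∈ n N≤n)) , (λ n<N → no-gap<N (n , n<N , n∉T)) ] (≤-<-connex N n)

insert : ℕ → (ℕ → Bool) → ℕ → Bool
insert a T n = T n ∨ (n ≡ᵇ a)

∈-insert⁺ : ∀ a T {n} → n ∈ₙ T ⊎ n ≡ a → n ∈ₙ insert a T
∈-insert⁺ a T {n} = to T-≡ ∘ from T-∨ ∘ Sum.map (from T-≡) (≡⇒≡ᵇ n a)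

∈-insert⁻ : ∀ a T {n} → n ∈ₙ insert a T → n ∈ₙ T ⊎ n ≡ a
∈-insert⁻ a T {n} = Sum.map (to T-≡) (≡ᵇ⇒≡ n a) ∘ to T-∨ ∘ from T-≡

⊊-insert : ∀ {a T} → a ∉ₙ T → T ⊊ insert a T
⊊-insert {a} {T} a∉T = (λ _ → ∈-insert⁺ a T ∘ inj₁) , a , ∈-insert⁺ a T (inj₂ refl) , a∉T

insert-numericalSemigroup : ∀ {a T} →
  NumericalSemigroup T → IsSpecialGap T a → NumericalSemigroup (insert a T)
insert-numericalSemigroup {a} {T} (0∈T , +-closed , N , ≥N⇒∈) ((_ , a+T⊆T) , a+a∈T) =
  ∈-insert⁺ a T (inj₁ 0∈T) ,
  (λ m n m∈ n∈ → ∈-insert⁺ a T (closed (∈-insert⁻ a T m∈) (∈-insert⁻ a T n∈))) ,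
  N , λ n N≤n → ∈-insert⁺ a T (inj₁ (≥N⇒∈ n N≤n))
  where
  a+ : ∀ {n} → n ∈ₙ T → (a + n) ∈ₙ T ⊎ a + n ≡ a
  a+ {n} n∈T with n ≟ 0
  ... | yes refl = inj₂ (+-identityʳ a)
  ... | no n≢0 = inj₁ (a+T⊆T n n∈T n≢0)
  closed : ∀ {m n} → m ∈ₙ T ⊎ m ≡ a → n ∈ₙ T ⊎ n ≡ a → (m + n) ∈ₙ T ⊎ m + n ≡ a
  closed (inj₁ m∈T) (inj₁ n∈T) = inj₁ (+-closed _ _ m∈T n∈T)
  closed (inj₂ refl) (inj₁ n∈T) = a+ n∈T
  closed {m} (inj₁ m∈T) (inj₂ refl) = subst (λ k → k ∈ₙ T ⊎ k ≡ a) (+-comm a m) (a+ m∈T)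
  closed (inj₂ refl) (inj₂ refl) = inj₁ a+a∈T

twoSpecialGaps⇒reducible : ∀ {T g g′} → NumericalSemigroup T →
  IsSpecialGap T g → IsSpecialGap T g′ → g ≢ g′ → ¬ Irreducible T
twoSpecialGaps⇒reducible {T} {g} {g′} ns sg sg′ g≢g′ irreducible = irreducible
  ( insert g T , insert g′ T
  , insert-numericalSemigroup ns sg , insert-numericalSemigroup ns sg′
  , ⊊-insert (proj₁ (proj₁ sg)) , ⊊-insert (proj₁ (proj₁ sg′))
  , λ n → mk⇔ (λ n∈T → ∈-insert⁺ g T (inj₁ n∈T) , ∈-insert⁺ g′ T (inj₁ n∈T))
              (λ (n∈ , n∈′) → intersect (∈-insert⁻ g T n∈) (∈-insert⁻ g′ T n∈′)))
  where
  intersect : ∀ {n} → n ∈ₙ T ⊎ n ≡ g → n ∈ₙ T ⊎ n ≡ g′ → n ∈ₙ T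
  intersect (inj₁ n∈T) _ = n∈T
  intersect (inj₂ _) (inj₁ n∈T) = n∈T
  intersect (inj₂ refl) (inj₂ g≡g′) = contradiction g≡g′ g≢g′

-- The classical characterisation of irreducible numerical semigroups (symmetric or pseudo-symmetric).
SymmetricUpToHalf : (ℕ → Bool) → ℕ → Set
SymmetricUpToHalf T F = ∀ h → h ∉ₙ T → h + h ≡ F ⊎ (F ∸ h) ∈ₙ T

OnlyPseudoFrobenius : (ℕ → Bool) → ℕ → Set
OnlyPseudoFrobenius T F = ∀ n → IsPseudoFrobenius T n → n ≡ F

module LargestGap {T : ℕ → Bool} (ns : NumericalSemigroup T) {F : ℕ} (largest : IsLargestGap T F)
  where

  open IsLargestGap largest

  0∈T : 0 ∈ₙ T
  0∈T = proj₁ ns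

  +-closed : ∀ m n → m ∈ₙ T → n ∈ₙ T → (m + n) ∈ₙ T
  +-closed = proj₁ (proj₂ ns)

  gap⇒≤F : ∀ {n} → n ∉ₙ T → n ≤ F
  gap⇒≤F n∉T = ≮⇒≥ (n∉T ∘ above)

  F-pseudoFrobenius : IsPseudoFrobenius T F
  F-pseudoFrobenius = gap , λ s _ s≢0 → above (m<m+n F (n≢0⇒n>0 s≢0))

  F-special : IsSpecialGap T F
  F-special = F-pseudoFrobenius , above (m<m+n F (n≢0⇒n>0 λ { refl → gap 0∈T }))

  -- A proper oversemigroup contains a gap h of T, hence F = h + h or F = h + (F ∸ h).
  symmetricUpToHalf⇒irreducible : SymmetricUpToHalf T F → Irreducible T
  symmetricUpToHalf⇒irreducible halfSym (_ , _ , ns₁ , ns₂ , T⊊T₁ , T⊊T₂ , T≡T₁∩T₂) =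
    gap (from (T≡T₁∩T₂ F) (F∈ ns₁ T⊊T₁ , F∈ ns₂ T⊊T₂))
    where
    F∈ : ∀ {T′} → NumericalSemigroup T′ → T ⊊ T′ → F ∈ₙ T′
    F∈ {T′} (_ , +-closed′ , _) (T⊆T′ , h , h∈T′ , h∉T) with halfSym h h∉T
    ... | inj₁ h+h≡F = subst (_∈ₙ T′) h+h≡F (+-closed′ h h h∈T′ h∈T′)
    ... | inj₂ F∸h∈T =
      subst (_∈ₙ T′) (m+[n∸m]≡n (gap⇒≤F h∉T)) (+-closed′ h (F ∸ h) h∈T′ (T⊆T′ _ F∸h∈T))

  Unpaired : ℕ → Set
  Unpaired g = g ∉ₙ T × (F ∸ g) ∉ₙ T × g + g ≢ F

  unpaired? : Decidable Unpaired
  unpaired? g = (g ∉ₙ? T) ×-dec ((F ∸ g) ∉ₙ? T) ×-dec ¬? (g + g ≟ F)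

  unpaired-mirror : ∀ {g} → g ≤ F → Unpaired g → Unpaired (F ∸ g)
  unpaired-mirror {g} g≤F (g∉T , F∸g∉T , g+g≢F) =
    F∸g∉T , subst (_∉ₙ T) (sym (m∸[m∸n]≡n g≤F)) g∉T , g+g≢F ∘ halves
    where
    halves : (F ∸ g) + (F ∸ g) ≡ F → g + g ≡ F
    halves eq = subst (λ k → g + k ≡ F) F∸g≡g (m+[n∸m]≡n g≤F)
      where
      F∸g≡g : F ∸ g ≡ g
      F∸g≡g = +-cancelʳ-≡ (F ∸ g) (F ∸ g) g (trans eq (sym (m+[n∸m]≡n g≤F)))

  module LargestUnpaired (G : Greatest Unpaired F) where
    open Greatest G renaming (value to g)

    F<g+g : F < g + g
    F<g+g with F <? g + g
    ... | yes F<g+g = F<g+g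
    ... | no F≮g+g = ⊥-elim (maximal g<F∸g (m∸n≤m F g) (unpaired-mirror ≤-bound holds))
      where
      g<F∸g : g < F ∸ g
      g<F∸g = m+n≤o⇒m≤o∸n (suc g) (≤∧≢⇒< (≮⇒≥ F≮g+g) (proj₂ (proj₂ holds)))

    unpaired-shift : ∀ {s} → s ∈ₙ T → (g + s) ∉ₙ T → Unpaired (g + s)
    unpaired-shift {s} s∈T g+s∉T = g+s∉T , F∸[g+s]∉T , F≢
      where
      F∸[g+s]∉T : (F ∸ (g + s)) ∉ₙ T
      F∸[g+s]∉T F∸[g+s]∈T =
        proj₁ (proj₂ holds) (subst (_∈ₙ T) shift (+-closed _ s F∸[g+s]∈T s∈T))
        where
        shift : F ∸ (g + s) + s ≡ F ∸ g
        shift = trans (cong (_+ s) (sym (∸-+-assoc F g s)))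
                      (m∸n+n≡m (m+n≤o⇒m≤o∸n s (subst (_≤ F) (+-comm g s) (gap⇒≤F g+s∉T))))
      F≢ : (g + s) + (g + s) ≢ F
      F≢ = >⇒≢ (<-≤-trans F<g+g (+-mono-≤ (m≤m+n g s) (m≤m+n g s)))

    special : IsSpecialGap T g
    special = (proj₁ holds , g+) , above F<g+g
      where
      g+ : ∀ s → s ∈ₙ T → s ≢ 0 → (g + s) ∈ₙ T
      g+ s s∈T s≢0 = decidable-stable ((g + s) ∈ₙ? T) λ g+s∉T →
        maximal (m<m+n g (n≢0⇒n>0 s≢0)) (gap⇒≤F g+s∉T) (unpaired-shift s∈T g+s∉T)

    g≢F : g ≢ F
    g≢F refl = proj₁ (proj₂ holds) (subst (_∈ₙ T) (sym (n∸n≡0 F)) 0∈T)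

  irreducible⇒symmetricUpToHalf : Irreducible T → SymmetricUpToHalf T F
  irreducible⇒symmetricUpToHalf irreducible h h∉T with h + h ≟ F | (F ∸ h) ∈ₙ? T
  ... | yes h+h≡F | _ = inj₁ h+h≡F
  ... | no _ | yes F∸h∈T = inj₂ F∸h∈T
  ... | no h+h≢F | no F∸h∉T =
    contradiction irreducible (twoSpecialGaps⇒reducible ns special F-special g≢F)
    where open LargestUnpaired (greatest unpaired? F (gap⇒≤F h∉T) (h∉T , F∸h∉T , h+h≢F))

  symmetricUpToHalf⇔irreducible : SymmetricUpToHalf T F ⇔ Irreducible T
  symmetricUpToHalf⇔irreducible = mk⇔ symmetricUpToHalf⇒irreducible irreducible⇒symmetricUpToHalf

  -- For a gap h, the largest gap g with g ∸ h ∈ T is pseudo-Frobenius, so it is F.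
  onlyPseudoFrobenius⇒symmetricUpToHalf : OnlyPseudoFrobenius T F → SymmetricUpToHalf T F
  onlyPseudoFrobenius⇒symmetricUpToHalf only h h∉T =
    inj₂ (subst (λ k → (k ∸ h) ∈ₙ T) (only g g-pseudoFrobenius) g∸h∈T)
    where
    GapAbove : ℕ → Set
    GapAbove g = g ∉ₙ T × (g ∸ h) ∈ₙ T × h ≤ g
    gapAbove? : Decidable GapAbove
    gapAbove? g = (g ∉ₙ? T) ×-dec ((g ∸ h) ∈ₙ? T) ×-dec (h ≤? g)
    h-gapAbove : GapAbove h
    h-gapAbove = h∉T , subst (_∈ₙ T) (sym (n∸n≡0 h)) 0∈T , ≤-refl
    open Greatest (greatest gapAbove? F (gap⇒≤F h∉T) h-gapAbove) renaming (value to g)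
    g∸h∈T : (g ∸ h) ∈ₙ T
    g∸h∈T = proj₁ (proj₂ holds)
    h≤g : h ≤ g
    h≤g = proj₂ (proj₂ holds)
    g-pseudoFrobenius : IsPseudoFrobenius T g
    g-pseudoFrobenius = proj₁ holds , λ s s∈T s≢0 →
      decidable-stable ((g + s) ∈ₙ? T) λ g+s∉T →
        maximal (m<m+n g (n≢0⇒n>0 s≢0)) (gap⇒≤F g+s∉T)
          ( g+s∉T
          , subst (_∈ₙ T) (sym (+-∸-comm s h≤g)) (+-closed _ s g∸h∈T s∈T)
          , ≤-trans h≤g (m≤m+n g s))

  pseudoFrobenius⇔≡F : OnlyPseudoFrobenius T F → ∀ n → IsPseudoFrobenius T n ⇔ n ≡ F
  pseudoFrobenius⇔≡F only n = mk⇔ (only n) λ { refl → F-pseudoFrobenius }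

  isFrobenius-F : IsFrobenius T (ℤ.+ F)
  isFrobenius-F = gap , λ { (ℤ.+ n) (+<+ F<n) → above F<n ; -[1+ _ ] () }

  isFrobenius⇒≡F : ∀ {z} → IsFrobenius T z → z ≡ ℤ.+ F
  isFrobenius⇒≡F {ℤ.+ n} (n∉T , >⇒∈) =
    cong ℤ.+_ (≤-antisym (gap⇒≤F n∉T) (≮⇒≥ λ n<F → gap (>⇒∈ (ℤ.+ F) (+<+ n<F))))
  isFrobenius⇒≡F { -[1+ n ]} (_ , >⇒∈) = contradiction (>⇒∈ (ℤ.+ F) -<+) gap

  -- -[1+ n ] + (F + suc n) = F is a gap although F + suc n ∈ T.
  negative-¬pseudoFrobenius : ∀ n → ¬ PFₙ T -[1+ n ]
  negative-¬pseudoFrobenius n (_ , +T⊆T) =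
    gap (subst (_∈ℤ T) shift (+T⊆T (F + suc n) (above F<F+1+n) (m<n⇒n≢0 F<F+1+n)))
    where
    F<F+1+n : F < F + suc n
    F<F+1+n = m<m+n F z<s
    shift : -[1+ n ] ℤ.+ ℤ.+ (F + suc n) ≡ ℤ.+ F
    shift = trans (ℤ.⊖-≥ (m≤n+m (suc n) F)) (cong ℤ.+_ (m+n∸n≡m F (suc n)))

  symmetric⇔onlyPseudoFrobenius : Symmetric T ⇔ OnlyPseudoFrobenius T F
  symmetric⇔onlyPseudoFrobenius = mk⇔
    (λ (_ , PF⇔Frob) n pf → ℤ.+-injective (isFrobenius⇒≡F (to (PF⇔Frob (ℤ.+ n)) pf)))
    (λ only →
      symmetricUpToHalf⇒irreducible (onlyPseudoFrobenius⇒symmetricUpToHalf only) , PF⇔Frob only)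
    where
    PF⇔Frob : OnlyPseudoFrobenius T F → ∀ z → PFₙ T z ⇔ IsFrobenius T z
    PF⇔Frob only (ℤ.+ n) = ⇔-trans (pseudoFrobenius⇔≡F only n) (mk⇔
      (λ { refl → isFrobenius-F })
      (ℤ.+-injective ∘ isFrobenius⇒≡F))
    PF⇔Frob only -[1+ n ] = mk⇔
      (⊥-elim ∘ negative-¬pseudoFrobenius n)
      (λ isF → contradiction (isFrobenius⇒≡F isF) λ ())

  module GradedGNS (d : ℕ) where

    S : Vec ℕ (suc d) → Set
    S = Graded (suc d) T

    fill : Vec ℕ (suc d) → Vec ℕ (suc d)
    fill x = x +ᵥ at₀ (F ∸ sum x)

    sum-fill : ∀ x → sum x ≤ F → sum (fill x) ≡ F
    sum-fill x sum≤F = trans (sum-+ᵥ-at₀ x (F ∸ sum x)) (m+[n∸m]≡n sum≤F)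

    FA⇔sum≡F : ∀ x → FA S x ⇔ sum x ≡ F
    FA⇔sum≡F x = mk⇔ FA⇒ ⇒FA
      where
      FA⇒ : FA S x → sum x ≡ F
      FA⇒ (x∉S , maximal) =
        trans (cong sum (sym (maximal (fill x) fill∉S (≤ᵥ-+ᵥ x _)))) (sum-fill x sum≤F)
        where
        sum≤F = gap⇒≤F x∉S
        fill∉S = gap ∘ subst (_∈ₙ T) (sum-fill x sum≤F)
      ⇒FA : sum x ≡ F → FA S x
      ⇒FA refl = gap , λ y y∉S x≤y →
        sym (≤ᵥ∧sum≡⇒≡ x≤y (≤-antisym (sum-mono-≤ᵥ x≤y) (gap⇒≤F y∉S)))

    PF⇔pseudoFrobenius : ∀ x → PF S x ⇔ IsPseudoFrobenius T (sum x)
    PF⇔pseudoFrobenius x = mk⇔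
      (λ (x∉S , +S⊆S) → x∉S , λ s s∈T s≢0 → subst (_∈ₙ T) (sum-+ᵥ-at₀ x s)
        (+S⊆S (at₀ s) (subst (_∈ₙ T) (sym (sum-at₀ {d} s)) s∈T) (s≢0 ∘ cong head)))
      (λ (x∉T , +T⊆T) → x∉T , λ s s∈S s≢𝟎 → subst (_∈ₙ T) (sym (sum-+ᵥ x s))
        (+T⊆T (sum s) s∈S (s≢𝟎 ∘ sum≡0⇒𝟎 s)))

    quasiIrreducible⇔symmetricUpToHalf : QuasiIrreducible S ⇔ SymmetricUpToHalf T F
    quasiIrreducible⇔symmetricUpToHalf = mk⇔ QI⇒ ⇒QI
      where
      QI⇒ : QuasiIrreducible S → SymmetricUpToHalf T F
      QI⇒ qi h h∉T with qi (at₀ {d} h) (h∉T ∘ subst (_∈ₙ T) (sum-at₀ {d} h))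
      ... | inj₁ FA-2h = inj₁ (trans (sym sum-2h) (to (FA⇔sum≡F _) FA-2h))
        where
        sum-2h : sum (at₀ {d} h +ᵥ at₀ {d} h) ≡ h + h
        sum-2h = trans (sum-+ᵥ-at₀ (at₀ {d} h) h) (cong (_+ h) (sum-at₀ {d} h))
      ... | inj₂ (G , FA-G , s , s∈S , refl) = inj₂ (subst (_∈ₙ T) F∸h≡s s∈S)
        where
        F∸h≡s : sum s ≡ F ∸ h
        F∸h≡s = begin
          sum s                        ≡⟨ m+n∸m≡n h (sum s) ⟨
          h + sum s ∸ h                ≡⟨ cong (λ k → k + sum s ∸ h) (sum-at₀ {d} h) ⟨
          sum (at₀ {d} h) + sum s ∸ h  ≡⟨ cong (_∸ h) (sum-+ᵥ (at₀ {d} h) s) ⟨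
          sum (at₀ {d} h +ᵥ s) ∸ h     ≡⟨ cong (_∸ h) (to (FA⇔sum≡F _) FA-G) ⟩
          F ∸ h                        ∎
          where open ≡-Reasoning
      ⇒QI : SymmetricUpToHalf T F → QuasiIrreducible S
      ⇒QI halfSym x x∉S with halfSym (sum x) x∉S
      ... | inj₁ 2x≡F = inj₁ (from (FA⇔sum≡F _) (trans (sum-+ᵥ x x) 2x≡F))
      ... | inj₂ F∸x∈T = inj₂
        ( fill x , from (FA⇔sum≡F _) (sum-fill x (gap⇒≤F x∉S))
        , at₀ (F ∸ sum x) , subst (_∈ₙ T) (sym (sum-at₀ {d} _)) F∸x∈T , refl)

    FA⊆PF : ∀ {x} → FA S x → PF S x
    FA⊆PF {x} FA-x = from (PF⇔pseudoFrobenius x)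
      (subst (IsPseudoFrobenius T) (sym (to (FA⇔sum≡F x) FA-x)) F-pseudoFrobenius)

    quasiSymmetric⇔onlyPseudoFrobenius : QuasiSymmetric S ⇔ OnlyPseudoFrobenius T F
    quasiSymmetric⇔onlyPseudoFrobenius = mk⇔ QS⇒ ⇒QS
      where
      QS⇒ : QuasiSymmetric S → OnlyPseudoFrobenius T F
      QS⇒ (_ , card-FA , card-PF) n pf = decidable-stable (n ≟ F) λ n≢F →
        ⊆-sameCard⇒⊇ FA⊆PF card-FA card-PF PF-n λ FA-n →
          n≢F (trans (sym (sum-at₀ {d} n)) (to (FA⇔sum≡F _) FA-n))
        where
        PF-n : PF S (at₀ n)
        PF-n = from (PF⇔pseudoFrobenius (at₀ n))
          (subst (IsPseudoFrobenius T) (sym (sum-at₀ {d} n)) pf)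
      ⇒QS : OnlyPseudoFrobenius T F → QuasiSymmetric S
      ⇒QS only = k ,
        HasCard-cong (λ x → ⇔-sym (FA⇔sum≡F x)) level ,
        HasCard-cong (λ x → ⇔-sym (⇔-trans (PF⇔pseudoFrobenius x) (pseudoFrobenius⇔≡F only (sum x))))
          level
        where
        open Σ (levelSet-finite (suc d) F) renaming (proj₁ to k; proj₂ to level)

module WithoutGaps {T : ℕ → Bool} (full : ∀ n → n ∈ₙ T) where

  irreducible : Irreducible T
  irreducible (_ , _ , _ , _ , (_ , h , _ , h∉T) , _) = h∉T (full h)

  -- The Frobenius number of ℕ is -1, also its only pseudo-Frobenius number.
  symmetric : Symmetric T
  symmetric = irreducible , PF⇔Frob
    where
    PF⇔Frob : ∀ z → PFₙ T z ⇔ IsFrobenius T z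
    PF⇔Frob (ℤ.+ n) = mk⇔
      (λ pf → ⊥-elim (proj₁ pf (full n)))
      (λ isF → ⊥-elim (proj₁ isF (full n)))
    PF⇔Frob -[1+ zero ] = mk⇔
      (const ((λ ()) , λ { (ℤ.+ n) _ → full n ; -[1+ _ ] (-<- ()) }))
      (const ((λ ()) , λ { zero _ 0≢0 → contradiction refl 0≢0 ; (suc s) _ _ → full s }))
    PF⇔Frob -[1+ suc n ] = mk⇔
      (λ pf → ⊥-elim (proj₂ pf 1 (full 1) λ ()))
      (λ isF → ⊥-elim (proj₂ isF -[1+ n ] (-<- ≤-refl)))

  quasiIrreducible : ∀ d → QuasiIrreducible (Graded d T)
  quasiIrreducible d x x∉S = ⊥-elim (x∉S (full _))

  quasiSymmetric : ∀ d → QuasiSymmetric (Graded d T)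
  quasiSymmetric d =
    0 , HasCard-∅ (λ x FA-x → proj₁ FA-x (full _)) , HasCard-∅ (λ x PF-x → proj₁ PF-x (full _))

corollary4p10 : (T : ℕ → Bool) → NumericalSemigroup T → (d : ℕ) → 1 ≤ d →
    (QuasiIrreducible (Graded d T) ⇔ Irreducible T) ×
    (QuasiSymmetric (Graded d T) ⇔ Symmetric T)
corollary4p10 T ns (suc d) _ with full-or-largestGap ns
... | inj₁ full =
  mk⇔ (const irreducible) (const (quasiIrreducible (suc d))) ,
  mk⇔ (const symmetric) (const (quasiSymmetric (suc d)))
  where open WithoutGaps full
... | inj₂ (F , largest) =
  ⇔-trans quasiIrreducible⇔symmetricUpToHalf symmetricUpToHalf⇔irreducible ,
  ⇔-trans quasiSymmetric⇔onlyPseudoFrobenius (⇔-sym symmetric⇔onlyPseudoFrobenius)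
  where
  open LargestGap ns largest
  open GradedGNS d
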